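{- The problem CUB can be accepted by a program scheme of $\mathrm{NPSB}(1)$.
   Context: CUB is the problem over the signature $\sigma_2=\langle E\rangle$ ($E$ binary) consisting of those $\sigma_2$-structures $\mathcal G$ such that the undirected graph with vertex set $|\mathcal G|$ and an edge $\{u,v\}$ iff $u\ne v$ and $E(u,v)\vee E(v,u)$ has a subset of edges inducing a regular subgraph of degree 3. Program schemes of $\mathrm{NPSA}(1)$ over $\sigma$: variables $x_1,\dots,x_k$ and array symbols of given dimensions; instructions begin with $\mathtt{input}(x_1,\dots,x_l)$ and end with $\mathtt{output}(x_1,\dots,x_l)$, others being assignments $x_i:=y$, $x_i:=A[y_1,\dots,y_d]$, $A[y_1,\dots,y_d]:=y_0$ ($y_j$ variables, constant symbols of $\sigma$, or special constants $0,max$), guesses $\mathtt{guess}\ x_i$ (nondeterministically any element), and while instructions with quantifier-free first-order tests over $\sigma\cup\{0,max\}$. On a finite $\sigma$-structure, $0$ and $max$ denote arbitrary distinct elements, input-output variables and array elements start at $0$, and the input is accepted iff some computation reaches the output instruction with all input-output variables equal to $max$; acceptance must be independent of the choice of $0,max$. $\mathrm{NPSB}(1)$ is the subclass in which every assignment to an array element has the form $A[y_1,\dots,y_d]:=max$. -}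

module Defs where

open import Data.Nat using (ℕ; _≤_)
open import Data.Fin using (Fin; _≟_; inject≤)
open import Data.Bool using (Bool; true; false; not; _∧_; _∨_; if_then_else_)
open import Data.List using (List; []; _∷_; map; allFin)
open import Data.Nat.ListAction using (sum)
open import Data.Vec using (Vec)
import Data.Vec as V
import Data.Vec.Properties as VP
open import Data.Product using (Σ; _×_; ∃)
open import Relation.Nullary using (¬_; yes; no)
open import Relation.Nullary.Decidable using (⌊_⌋)
open import Relation.Binary.PropositionalEquality using (_≡_)

Rel₂ : ℕ → Set
Rel₂ n = Fin n → Fin n → Bool

adj : ∀ {n} → Rel₂ n → Fin n → Fin n → Bool
adj E u v = not ⌊ u ≟ v ⌋ ∧ (E u v ∨ E v u)

degree : ∀ {n} → Rel₂ n → Fin n → ℕ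
degree {n} F u = sum (map (λ v → if F u v then 1 else 0) (allFin n))

-- A nonempty set of edges F of the underlying graph such that the
-- subgraph it induces (the vertices incident to F, with edges F) is
-- 3-regular: every vertex has F-degree 0 (not in the subgraph) or 3.
CUB : (n : ℕ) → Rel₂ n → Set
CUB n E = Σ (Rel₂ n) λ F →
    (∀ u v → F u v ≡ F v u)
  × (∀ u v → F u v ≡ true → adj E u v ≡ true)
  × (∃ λ u → ∃ λ v → F u v ≡ true)
  × (∀ u → (degree F u ≡ 0) Data.Sum.⊎ (degree F u ≡ 3))
  where import Data.Sum

-- Syntax of program schemes over σ₂ (no constant symbols).
-- k variables x₀..x_{k-1}; a arrays, array A having dimension dims A.

data Term (k : ℕ) : Set where
  var  : Fin k → Term k
  c0   : Term k
  cmax : Term k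

data Test (k : ℕ) : Set where
  tt   : Test k
  relE : Term k → Term k → Test k
  eq   : Term k → Term k → Test k
  neg  : Test k → Test k
  and  : Test k → Test k → Test k
  or   : Test k → Test k → Test k

data Instr (k a : ℕ) (dims : Fin a → ℕ) : Set where
  assign : Fin k → Term k → Instr k a dims
  read   : Fin k → (A : Fin a) → Vec (Term k) (dims A) → Instr k a dims
  write  : (A : Fin a) → Vec (Term k) (dims A) → Term k → Instr k a dims
  guess  : Fin k → Instr k a dims
  while  : Test k → List (Instr k a dims) → Instr k a dims

-- A program scheme: input(x₀..x_{l-1}); body; output(x₀..x_{l-1}).
record Program : Set where
  field
    k    : ℕ
    l    : ℕ
    l≤k  : l ≤ k
    a    : ℕ
    dims : Fin a → ℕ
    body : List (Instr k a dims)

mutual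
  NPSBᵢ : ∀ {k a dims} → Instr k a dims → Set
  NPSBᵢ (assign _ _)  = Data.Unit.⊤
  NPSBᵢ (read _ _ _)  = Data.Unit.⊤
  NPSBᵢ (write _ _ t) = t ≡ cmax
  NPSBᵢ (guess _)     = Data.Unit.⊤
  NPSBᵢ (while _ b)   = NPSBₗ b

  NPSBₗ : ∀ {k a dims} → List (Instr k a dims) → Set
  NPSBₗ []       = Data.Unit.⊤
  NPSBₗ (i ∷ is) = NPSBᵢ i × NPSBₗ is

  import Data.Unit

IsNPSB : Program → Set
IsNPSB P = NPSBₗ (Program.body P)

record State (n k a : ℕ) (dims : Fin a → ℕ) : Set where
  constructor st
  field
    vars : Fin k → Fin n
    arrs : (A : Fin a) → Vec (Fin n) (dims A) → Fin n

module Semantics {n : ℕ} (E : Rel₂ n) (z m : Fin n)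
                 {k a : ℕ} {dims : Fin a → ℕ} where

  St = State n k a dims

  evT : St → Term k → Fin n
  evT s (var i) = State.vars s i
  evT s c0      = z
  evT s cmax    = m

  evTs : ∀ {d} → St → Vec (Term k) d → Vec (Fin n) d
  evTs s ts = V.map (evT s) ts

  evF : St → Test k → Bool
  evF s tt         = true
  evF s (relE t u) = E (evT s t) (evT s u)
  evF s (eq t u)   = ⌊ evT s t ≟ evT s u ⌋
  evF s (neg φ)    = not (evF s φ)
  evF s (and φ ψ)  = evF s φ ∧ evF s ψ
  evF s (or φ ψ)   = evF s φ ∨ evF s ψ

  setVar : St → Fin k → Fin n → St
  setVar (st vs as) x e = st (λ j → if ⌊ j ≟ x ⌋ then e else vs j) as

  setArr : St → (A : Fin a) → Vec (Fin n) (dims A) → Fin n → St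
  setArr (st vs as) A is e =
    st vs (λ B js → upd B js)
    where
      upd : (B : Fin a) → Vec (Fin n) (dims B) → Fin n
      upd B js with B ≟ A
      ... | no _ = as B js
      upd B js | yes Relation.Binary.PropositionalEquality.refl with VP.≡-dec _≟_ js is
      ... | yes _ = e
      ... | no _  = as B js

  mutual
    data ExecI : Instr k a dims → St → St → Set where
      assignE : ∀ {s x t} → ExecI (assign x t) s (setVar s x (evT s t))
      readE   : ∀ {s x A ts} →
                ExecI (read x A ts) s (setVar s x (State.arrs s A (evTs s ts)))
      writeE  : ∀ {s A ts t} →
                ExecI (write A ts t) s (setArr s A (evTs s ts) (evT s t))
      guessE  : ∀ {s x} (e : Fin n) → ExecI (guess x) s (setVar s x e)
      whileF  : ∀ {s φ b} → evF s φ ≡ false → ExecI (while φ b) s s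
      whileT  : ∀ {s s′ s″ φ b} → evF s φ ≡ true → ExecL b s s′ →
                ExecI (while φ b) s′ s″ → ExecI (while φ b) s s″

    data ExecL : List (Instr k a dims) → St → St → Set where
      done : ∀ {s} → ExecL [] s s
      step : ∀ {i is s s′ s″} → ExecI i s s′ → ExecL is s′ s″ → ExecL (i ∷ is) s s″

Accepts : Program → (n : ℕ) → Rel₂ n → (z m : Fin n) → Set
Accepts P n E z m =
  Σ (State n k a dims) λ s →
      ExecL body (st (λ _ → z) (λ _ _ → z)) s
    × (∀ (i : Fin l) → State.vars s (inject≤ i l≤k) ≡ m)
  where
    open Program P
    open Semantics E z m {k} {a} {dims}

-- P accepts the problem Q: for every finite structure and every choice of
-- distinct 0, max, P accepts iff the structure is in Q (so in particular
-- acceptance is independent of the choice of 0, max).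
AcceptsProblem : Program → ((n : ℕ) → Rel₂ n → Set) → Set
AcceptsProblem P Q =
  ∀ (n : ℕ) (E : Rel₂ n) (z m : Fin n) → ¬ (z ≡ m) →
    (Accepts P n E z m → Q n E) × (Q n E → Accepts P n E z m)

-- The scheme guesses a path s = t₀ ← t₁ ← ⋯ ← tₖ of vertices. Each new vertex is first checked
-- to be unmarked, then marked in the unary array inSub, linked to its predecessor in link, and
-- given three guessed distinct neighbours, one in each of the arrays nbr₀, nbr₁, nbr₂. The scheme
-- then walks back along link from tₖ to s and checks at every vertex x that x is in turn a chosen
-- neighbour of each of its three chosen neighbours. Because a vertex is marked at most once, the
-- links form one path ending at s, so the walk visits every marked vertex. The chosen pairs
-- therefore form a symmetric edge set where marked vertices have degree 3 and all others degree 0.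
-- Conversely, for a cubic subgraph F, some run marks every vertex of F-degree 3 together with
-- exactly its F-neighbours, and the walk back succeeds because F is symmetric. Arrays are only
-- ever set to max, so the scheme is in NPSB(1).

module Submission where

open import Defs
open import Data.Bool using (Bool; true; false; not; _∧_; _∨_; if_then_else_)
open import Data.Bool.Properties using (∧-identityʳ; ∧-zeroʳ; ¬-not; not-injective; ⇔→≡)
open import Data.Empty using (⊥-elim)
open import Data.Fin using (Fin; zero; suc; #_; _≟_)
open import Data.Fin.Properties using (any?)
import Data.Fin.Properties as Finₚ
open import Data.List using (List; []; _∷_; _++_; map; allFin)
open import Data.List.Membership.Propositional using (_∈_)
open import Data.List.Membership.Propositional.Properties using (∈-allFin)
open import Data.List.Properties using (map-tabulate)
open import Data.List.Relation.Unary.Any using (here; there)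
open import Data.Nat using (ℕ; zero; suc; _+_; z≤n; s≤s)
import Data.Nat as ℕ
open import Data.Nat.ListAction using (sum)
open import Data.Nat.Properties using (+-suc)
import Data.Nat.Properties as ℕₚ
open import Data.Product using (Σ; ∃; ∃₂; _×_; _,_; proj₁; proj₂; uncurry)
open import Data.Product.Function.NonDependent.Propositional using (_×-⇔_)
open import Data.Sum using (_⊎_; inj₁; inj₂; [_,_]′)
open import Data.Sum.Function.Propositional using (_⊎-⇔_)
open import Data.Unit using (⊤; tt)
open import Data.Vec using (Vec; []; _∷_; lookup)
open import Data.Vec.Properties using (∷-injectiveˡ; ∷-injectiveʳ)
import Data.Vec.Properties as Vecₚ
import Data.Vec.Functional as Vector
open import Function using (_∘_; id; const; case_of_)
open import Function.Bundles using (_⇔_; mk⇔; Equivalence)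
open import Function.Definitions using (Injective)
open import Function.Related.TypeIsomorphisms using (¬-cong-⇔)
import Function.Properties.Equivalence as ⇔
open import Relation.Binary.PropositionalEquality using (_≡_; _≢_; refl; sym; trans; cong; cong₂; subst; module ≡-Reasoning)
open import Relation.Nullary using (¬_; Dec; yes; no; does)
open import Relation.Nullary.Decidable using (⌊_⌋; _×-dec_; toWitness; decidable-stable)

open Equivalence using (to; from)

𝟙 : Bool → ℕ
𝟙 b = if b then 1 else 0

-- `degree F u` unfolds to `count (F u)`.
count : ∀ {n} → (Fin n → Bool) → ℕ
count {n} g = sum (map (𝟙 ∘ g) (allFin n))

count-suc : ∀ {n} (g : Fin (suc n) → Bool) → count g ≡ 𝟙 (g zero) + count (g ∘ suc)
count-suc g = cong (𝟙 (g zero) +_) (cong sum (trans (map-tabulate suc h) (sym (map-tabulate id (h ∘ suc)))))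
  where h = 𝟙 ∘ g

count-cong : ∀ {n} {g h : Fin n → Bool} → (∀ v → g v ≡ h v) → count g ≡ count h
count-cong {zero}  g≗h = refl
count-cong {suc n} {g} {h} g≗h = begin
  count g                       ≡⟨ count-suc g ⟩
  𝟙 (g zero) + count (g ∘ suc)  ≡⟨ cong₂ (λ b c → 𝟙 b + c) (g≗h zero) (count-cong (g≗h ∘ suc)) ⟩
  𝟙 (h zero) + count (h ∘ suc)  ≡⟨ count-suc h ⟨
  count h                       ∎
  where open ≡-Reasoning

count-none : ∀ {n} {g : Fin n → Bool} → (∀ v → g v ≡ false) → count g ≡ 0
count-none {zero}  none = refl
count-none {suc n} {g} none = begin
  count g                       ≡⟨ count-suc g ⟩
  𝟙 (g zero) + count (g ∘ suc)  ≡⟨ cong₂ (λ b c → 𝟙 b + c) (none zero) (count-none (none ∘ suc)) ⟩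
  0                             ∎
  where open ≡-Reasoning

remove : ∀ {n} → (Fin n → Bool) → Fin n → Fin n → Bool
remove g a v = g v ∧ not (does (v ≟ a))

remove-true : ∀ {n} (g : Fin n → Bool) a v → remove g a v ≡ true ⇔ (g v ≡ true × v ≢ a)
remove-true g a v with g v | v ≟ a
... | true  | yes v≡a = mk⇔ (λ ()) (λ (_ , v≢a) → ⊥-elim (v≢a v≡a))
... | true  | no  v≢a = mk⇔ (λ _ → refl , v≢a) (λ _ → refl)
... | false | _       = mk⇔ (λ ()) (λ ())

count-remove : ∀ {n} (g : Fin n → Bool) {a} → g a ≡ true → count g ≡ suc (count (remove g a))
count-remove {suc n} g {zero} ga = begin
  count g                                           ≡⟨ count-suc g ⟩
  𝟙 (g zero) + count (g ∘ suc)                      ≡⟨ cong₂ (λ b c → 𝟙 b + c) ga rest ⟩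
  suc (count (g′ ∘ suc))                            ≡⟨ cong (λ b → suc (𝟙 b + count (g′ ∘ suc))) (∧-zeroʳ _) ⟨
  suc (𝟙 (g′ zero) + count (g′ ∘ suc))              ≡⟨ cong suc (count-suc g′) ⟨
  suc (count g′)                                    ∎
  where
    open ≡-Reasoning
    g′ = remove g zero
    rest : count (g ∘ suc) ≡ count (g′ ∘ suc)
    rest = count-cong λ v → sym (∧-identityʳ (g (suc v)))
count-remove {suc n} g {suc a} ga = begin
  count g                                           ≡⟨ count-suc g ⟩
  𝟙 (g zero) + count (g ∘ suc)                      ≡⟨ cong (𝟙 (g zero) +_) (count-remove (g ∘ suc) ga) ⟩
  𝟙 (g zero) + suc (count (g′ ∘ suc))               ≡⟨ +-suc _ _ ⟩
  suc (𝟙 (g zero) + count (g′ ∘ suc))               ≡⟨ cong (λ b → suc (𝟙 b + count (g′ ∘ suc))) (∧-identityʳ _) ⟨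
  suc (𝟙 (g′ zero) + count (g′ ∘ suc))              ≡⟨ cong suc (count-suc g′) ⟨
  suc (count g′)                                    ∎
  where
    open ≡-Reasoning
    g′ = remove g (suc a)

count-some : ∀ {n} (g : Fin n → Bool) {k} → count g ≡ suc k → ∃ λ a → g a ≡ true
count-some {zero} g ()
count-some {suc n} g c = search (g zero) refl
  where
    search : ∀ b → g zero ≡ b → ∃ λ a → g a ≡ true
    search true  g0 = zero , g0
    search false g0 = let a , ga = count-some (g ∘ suc) (trans (sym skip) c) in suc a , ga
      where
        skip : count g ≡ count (g ∘ suc)
        skip = trans (count-suc g) (cong (λ b → 𝟙 b + count (g ∘ suc)) g0)

count≢0 : ∀ {n} (g : Fin n → Bool) {a} → g a ≡ true → count g ≢ 0
count≢0 g ga c with () ← trans (sym (count-remove g ga)) c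

record Enumerates {n k} (f : Fin k → Fin n) (g : Fin n → Bool) : Set where
  field
    injective : Injective _≡_ _≡_ f
    image     : ∀ v → g v ≡ true ⇔ ∃ λ j → f j ≡ v

count-enumerated : ∀ {n k} {f : Fin k → Fin n} {g} → Enumerates f g → count g ≡ k
count-enumerated {k = zero} e = count-none λ v → ¬-not λ gv → case proj₁ (to (image v) gv) of λ ()
  where open Enumerates e
count-enumerated {k = suc k} {f} {g} e =
  trans (count-remove g (from (image (f zero)) (zero , refl))) (cong suc (count-enumerated e′))
  where
    open Enumerates e
    e′ : Enumerates (f ∘ suc) (remove g (f zero))
    e′ = record
      { injective = Finₚ.suc-injective ∘ injective
      ; image     = λ v → mk⇔
          (λ r → case to (image v) (proj₁ (to (remove-true g (f zero) v) r)) of λ where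
             (zero  , f0≡v) → ⊥-elim (proj₂ (to (remove-true g (f zero) v) r) (sym f0≡v))
             (suc j , fj≡v) → j , fj≡v)
          (λ (j , fj≡v) → from (remove-true g (f zero) v)
             ( from (image v) (suc j , fj≡v)
             , λ v≡f0 → case injective (trans fj≡v v≡f0) of λ ()))
      }

enumerate : ∀ {n k} (g : Fin n → Bool) → count g ≡ k → ∃ λ (f : Fin k → Fin n) → Enumerates f g
enumerate {k = zero} g c = (λ ()) , record
  { injective = λ {x} → case x of λ ()
  ; image     = λ v → mk⇔ (λ gv → ⊥-elim (count≢0 g gv c)) (λ ()) }
enumerate {k = suc k} g c = (a Vector.∷ f) , record { injective = injective′ ; image = image′ }
  where
    a  = proj₁ (count-some g c)
    ga = proj₂ (count-some g c)
    rest = enumerate (remove g a) (ℕₚ.suc-injective (trans (sym (count-remove g ga)) c))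
    f  = proj₁ rest
    open Enumerates (proj₂ rest)

    f≢a : ∀ j → f j ≢ a
    f≢a j = proj₂ (to (remove-true g a (f j)) (from (image (f j)) (j , refl)))

    injective′ : Injective _≡_ _≡_ (a Vector.∷ f)
    injective′ {zero}  {zero}  _     = refl
    injective′ {zero}  {suc j} a≡fj  = ⊥-elim (f≢a j (sym a≡fj))
    injective′ {suc i} {zero}  fi≡a  = ⊥-elim (f≢a i fi≡a)
    injective′ {suc i} {suc j} fi≡fj = cong suc (injective fi≡fj)

    image′ : ∀ v → g v ≡ true ⇔ ∃ λ j → (a Vector.∷ f) j ≡ v
    image′ v = mk⇔
      (λ gv → case v ≟ a of λ where
         (yes v≡a) → zero , sym v≡a
         (no  v≢a) → let j , fj≡v = to (image v) (from (remove-true g a v) (gv , v≢a))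
                      in  suc j , fj≡v)
      (λ where
         (zero  , refl) → ga
         (suc j , fj≡v) → proj₁ (to (remove-true g a v) (from (image v) (j , fj≡v))))

∧≡true⇔ : ∀ {a b} → a ∧ b ≡ true ⇔ (a ≡ true × b ≡ true)
∧≡true⇔ {true}  = mk⇔ (refl ,_) proj₂
∧≡true⇔ {false} = mk⇔ (λ ()) (λ ())

∨≡true⇔ : ∀ {a b} → a ∨ b ≡ true ⇔ (a ≡ true ⊎ b ≡ true)
∨≡true⇔ {true}  = mk⇔ inj₁ (const refl)
∨≡true⇔ {false} = mk⇔ inj₂ [ (λ ()) , id ]′

not≡true⇔ : ∀ {a} → not a ≡ true ⇔ (¬ a ≡ true)
not≡true⇔ {true}  = mk⇔ (λ ()) (λ ¬t → ⊥-elim (¬t refl))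
not≡true⇔ {false} = mk⇔ (λ _ ()) (const refl)

⌊⌋≡true⇔ : ∀ {p} {P : Set p} (P? : Dec P) → ⌊ P? ⌋ ≡ true ⇔ P
⌊⌋≡true⇔ (yes p)  = mk⇔ (const p) (const refl)
⌊⌋≡true⇔ (no ¬p) = mk⇔ (λ ()) (⊥-elim ∘ ¬p)

∷[]-≡⇔ : ∀ {A : Set} {x y : A} → (x ∷ []) ≡ (y ∷ []) ⇔ x ≡ y
∷[]-≡⇔ = mk⇔ ∷-injectiveˡ (cong (_∷ []))

∷∷[]-≡⇔ : ∀ {A : Set} {x y u v : A} → (u ∷ v ∷ []) ≡ (x ∷ y ∷ []) ⇔ (u ≡ x × v ≡ y)
∷∷[]-≡⇔ = mk⇔ (λ e → ∷-injectiveˡ e , ∷-injectiveˡ (∷-injectiveʳ e)) (λ { (refl , refl) → refl })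

distinct⇒injective : ∀ {A : Set} {f : Fin 3 → A} →
                     f zero ≢ f (# 1) → f zero ≢ f (# 2) → f (# 1) ≢ f (# 2) → Injective _≡_ _≡_ f
distinct⇒injective d01 d02 d12 {zero}             {zero}             _ = refl
distinct⇒injective d01 d02 d12 {zero}             {suc zero}         e = ⊥-elim (d01 e)
distinct⇒injective d01 d02 d12 {zero}             {suc (suc zero)}   e = ⊥-elim (d02 e)
distinct⇒injective d01 d02 d12 {suc zero}         {zero}             e = ⊥-elim (d01 (sym e))
distinct⇒injective d01 d02 d12 {suc zero}         {suc zero}         _ = refl
distinct⇒injective d01 d02 d12 {suc zero}         {suc (suc zero)}   e = ⊥-elim (d12 e)
distinct⇒injective d01 d02 d12 {suc (suc zero)}   {zero}             e = ⊥-elim (d02 (sym e))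
distinct⇒injective d01 d02 d12 {suc (suc zero)}   {suc zero}         e = ⊥-elim (d12 (sym e))
distinct⇒injective d01 d02 d12 {suc (suc zero)}   {suc (suc zero)}   _ = refl

⊎³⇔∃ : ∀ {P : Fin 3 → Set} → (P zero ⊎ P (# 1) ⊎ P (# 2)) ⇔ ∃ P
⊎³⇔∃ = mk⇔ [ (zero ,_) , [ (# 1 ,_) , (# 2 ,_) ]′ ]′
  λ { (zero , p) → inj₁ p ; (suc zero , p) → inj₂ (inj₁ p) ; (suc (suc zero) , p) → inj₂ (inj₂ p) }

-- A run passes `assert φ` only if φ holds; otherwise it is trapped in a loop that never ends.
assert : ∀ {k a dims} → Test k → Instr k a dims
assert φ = while (neg φ) (while tt [] ∷ [])

-- Runs `body` any number of times: another round starts only while a freshly guessed `c` is 0.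
repeat : ∀ {k a dims} → Fin k → List (Instr k a dims) → List (Instr k a dims)
repeat c body = guess c ∷ while (eq (var c) c0) (body ++ guess c ∷ []) ∷ []

isCmax? : ∀ {k} (t : Term k) → Dec (t ≡ cmax)
isCmax? (var _) = no λ ()
isCmax? c0      = no λ ()
isCmax? cmax    = yes refl

mutual
  npsbᵢ? : ∀ {k a dims} (i : Instr k a dims) → Dec (NPSBᵢ i)
  npsbᵢ? (assign _ _)  = yes tt
  npsbᵢ? (read _ _ _)  = yes tt
  npsbᵢ? (write _ _ t) = isCmax? t
  npsbᵢ? (guess _)     = yes tt
  npsbᵢ? (while _ b)   = npsbₗ? b

  npsbₗ? : ∀ {k a dims} (is : List (Instr k a dims)) → Dec (NPSBₗ is)
  npsbₗ? []       = yes tt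
  npsbₗ? (i ∷ is) = npsbᵢ? i ×-dec npsbₗ? is

module Execution {n : ℕ} (E : Rel₂ n) (z m : Fin n) {k a : ℕ} {dims : Fin a → ℕ} where
  open Semantics E z m {k} {a} {dims} public

  Instrs : Set
  Instrs = List (Instr k a dims)

  Holds : St → Test k → Set
  Holds s tt         = ⊤
  Holds s (relE t u) = E (evT s t) (evT s u) ≡ true
  Holds s (eq t u)   = evT s t ≡ evT s u
  Holds s (neg φ)    = ¬ Holds s φ
  Holds s (and φ ψ)  = Holds s φ × Holds s ψ
  Holds s (or φ ψ)   = Holds s φ ⊎ Holds s ψ

  evF≡true⇔ : ∀ s φ → evF s φ ≡ true ⇔ Holds s φ
  evF≡true⇔ s tt         = mk⇔ _ (const refl)
  evF≡true⇔ s (relE t u) = ⇔.refl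
  evF≡true⇔ s (eq t u)   = ⌊⌋≡true⇔ (evT s t ≟ evT s u)
  evF≡true⇔ s (neg φ)    = ⇔.trans not≡true⇔ (¬-cong-⇔ (evF≡true⇔ s φ))
  evF≡true⇔ s (and φ ψ)  = ⇔.trans ∧≡true⇔ (evF≡true⇔ s φ ×-⇔ evF≡true⇔ s ψ)
  evF≡true⇔ s (or φ ψ)   = ⇔.trans ∨≡true⇔ (evF≡true⇔ s φ ⊎-⇔ evF≡true⇔ s ψ)

  evF≡false : ∀ s φ → ¬ Holds s φ → evF s φ ≡ false
  evF≡false s φ ¬φ = ¬-not (¬φ ∘ to (evF≡true⇔ s φ))

  setVar-≡ : ∀ s x e → State.vars (setVar s x e) x ≡ e
  setVar-≡ s x e with x ≟ x
  ... | yes _   = refl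
  ... | no x≢x = ⊥-elim (x≢x refl)

  setArr-≡ : ∀ s A is e → State.arrs (setArr s A is e) A is ≡ e
  setArr-≡ s A is e with A ≟ A
  ... | no A≢A = ⊥-elim (A≢A refl)
  ... | yes refl with Vecₚ.≡-dec _≟_ is is
  ...   | yes _     = refl
  ...   | no is≢is = ⊥-elim (is≢is refl)

  setArr-≢ : ∀ s A is e js → js ≢ is → State.arrs (setArr s A is e) A js ≡ State.arrs s A js
  setArr-≢ s A is e js js≢is with A ≟ A
  ... | no A≢A = ⊥-elim (A≢A refl)
  ... | yes refl with Vecₚ.≡-dec _≟_ js is
  ...   | yes js≡is = ⊥-elim (js≢is js≡is)
  ...   | no _      = refl

  setArr-max : ∀ s A is js →
               State.arrs (setArr s A is m) A js ≡ m ⇔ (js ≡ is ⊎ State.arrs s A js ≡ m)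
  setArr-max s A is js with Vecₚ.≡-dec _≟_ js is
  ... | yes refl  = mk⇔ (const (inj₁ refl)) (const (setArr-≡ s A is m))
  ... | no js≢is = mk⇔ (inj₂ ∘ trans (sym (setArr-≢ s A is m js js≢is)))
                       [ ⊥-elim ∘ js≢is , trans (setArr-≢ s A is m js js≢is) ]′

  ExecL-++⁺ : ∀ {xs ys : Instrs} {s s′ s″} → ExecL xs s s′ → ExecL ys s′ s″ → ExecL (xs ++ ys) s s″
  ExecL-++⁺ done        ys = ys
  ExecL-++⁺ (step i xs) ys = step i (ExecL-++⁺ xs ys)

  ExecL-++⁻ : ∀ (xs : Instrs) {ys s s″} → ExecL (xs ++ ys) s s″ → ∃ λ s′ → ExecL xs s s′ × ExecL ys s′ s″
  ExecL-++⁻ []       r          = _ , done , r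
  ExecL-++⁻ (x ∷ xs) (step i r) = let s′ , r₁ , r₂ = ExecL-++⁻ xs r in s′ , step i r₁ , r₂

  spin-diverges : ∀ {s s′} → ¬ ExecI (while tt []) s s′
  spin-diverges (whileF ())
  spin-diverges (whileT _ done r) = spin-diverges r

  assert⁻ : ∀ {φ is s s′} → ExecL (assert φ ∷ is) s s′ → Holds s φ × ExecL is s s′
  assert⁻ {φ} {s = s} (step (whileF ¬φ) r) = to (evF≡true⇔ s φ) (not-injective ¬φ) , r
  assert⁻ (step (whileT _ (step spin _) _) _) = ⊥-elim (spin-diverges spin)

  assert⁺ : ∀ {φ is s s′} → Holds s φ → ExecL is s s′ → ExecL (assert φ ∷ is) s s′
  assert⁺ {φ} {s = s} h r = step (whileF (evF≡false s (neg φ) (λ ¬φ → ¬φ h))) r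

  data Iterates (c : Fin k) (body : Instrs) : St → St → Set where
    []  : ∀ {s} → Iterates c body s s
    _∷_ : ∀ {s s₁ s₂} → ExecL body (setVar s c z) s₁ → Iterates c body s₁ s₂ → Iterates c body s s₂

  repeat⁺ : z ≢ m → ∀ {c body s s′} → Iterates c body s s′ → ExecL (repeat c body) s (setVar s′ c m)
  repeat⁺ z≢m {c} {s′ = s′} [] =
    step (guessE m) (step (whileF (evF≡false (setVar s′ c m) (eq (var c) c0) c≢0)) done)
    where
      c≢0 : State.vars (setVar s′ c m) c ≢ z
      c≢0 c≡0 = z≢m (trans (sym c≡0) (setVar-≡ s′ c m))
  repeat⁺ z≢m {c} {s = s} (r ∷ rs) with repeat⁺ z≢m rs
  ... | step (guessE e) (step loop done) =
    step (guessE z) (step (whileT (from (evF≡true⇔ (setVar s c z) (eq (var c) c0)) (setVar-≡ s c z))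
                                  (ExecL-++⁺ r (step (guessE e) done)) loop) done)

  repeat-invariant : ∀ {c body} (I : St → Set) → (∀ s e → I s → I (setVar s c e)) →
                     (∀ {s s′} → I s → ExecL body s s′ → I s′) →
                     ∀ {s s′} → I s → ExecL (repeat c body) s s′ → I s′
  repeat-invariant {c} {body} I I-c I-body i (step (guessE e) (step loop done)) = go (I-c _ e i) loop
    where
      go : ∀ {s s′} → I s → ExecI (while (eq (var c) c0) (body ++ guess c ∷ [])) s s′ → I s′
      go i (whileF _) = i
      go i (whileT _ r loop) with ExecL-++⁻ body r
      ... | _ , r₁ , step (guessE e) done = go (I-c _ e (I-body i r₁)) loop

K : ℕ
K = 14

out current start ctrl new cursor next witness : Fin K
out     = # 0
current = # 1
start   = # 2
ctrl    = # 3
new     = # 4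
cursor  = # 5
next    = # 6
witness = # 7

choice reg : Fin 3 → Fin K
choice zero             = # 8
choice (suc zero)       = # 9
choice (suc (suc zero)) = # 10
reg zero             = # 11
reg (suc zero)       = # 12
reg (suc (suc zero)) = # 13

arity : Fin 5 → ℕ
arity zero    = 1
arity (suc _) = 2

inSub link : Fin 5
inSub = # 0
link  = # 1

nbr : Fin 3 → Fin 5
nbr j = suc (suc j)

Ins : Set
Ins = Instr K 5 arity

pair : Fin K → Fin K → Vec (Term K) 2
pair x y = var x ∷ var y ∷ []

isMax : Fin K → Test K
isMax x = eq (var x) cmax

distinct : Fin K → Fin K → Test K
distinct x y = neg (eq (var x) (var y))

adjacent : Fin K → Fin K → Test K
adjacent x y = and (distinct x y) (or (relE (var x) (var y)) (relE (var y) (var x)))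

neighboursTest : Test K
neighboursTest =
  and (adjacent current (choice zero))
 (and (adjacent current (choice (# 1)))
 (and (adjacent current (choice (# 2)))
 (and (distinct (choice zero) (choice (# 1)))
 (and (distinct (choice zero) (choice (# 2)))
      (distinct (choice (# 1)) (choice (# 2)))))))

chooseNeighbours : List Ins
chooseNeighbours =
    write inSub (var current ∷ []) cmax
  ∷ guess (choice zero) ∷ guess (choice (# 1)) ∷ guess (choice (# 2))
  ∷ assert neighboursTest
  ∷ write (nbr zero)  (pair current (choice zero))  cmax
  ∷ write (nbr (# 1)) (pair current (choice (# 1))) cmax
  ∷ write (nbr (# 2)) (pair current (choice (# 2))) cmax
  ∷ []

initialise : List Ins
initialise = guess current ∷ chooseNeighbours ++ assign start (var current) ∷ []

extend : List Ins
extend =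
    guess new ∷ read (reg zero) inSub (var new ∷ []) ∷ assert (neg (isMax (reg zero)))
  ∷ write link (pair new current) cmax ∷ assign current (var new)
  ∷ chooseNeighbours

-- The `j`-th chosen neighbour of the cursor must have the cursor among its own chosen neighbours.
checkSlot : Fin 3 → List Ins
checkSlot j =
    guess witness ∷ read (reg zero) (nbr j) (pair cursor witness) ∷ assert (isMax (reg zero))
  ∷ read (reg zero) (nbr zero) (pair witness cursor)
  ∷ read (reg (# 1)) (nbr (# 1)) (pair witness cursor)
  ∷ read (reg (# 2)) (nbr (# 2)) (pair witness cursor)
  ∷ assert (or (isMax (reg zero)) (or (isMax (reg (# 1))) (isMax (reg (# 2)))))
  ∷ []

checkSymmetric : List Ins
checkSymmetric = checkSlot zero ++ checkSlot (# 1) ++ checkSlot (# 2)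

stepBack : List Ins
stepBack =
  checkSymmetric ++
  guess next ∷ read (reg zero) link (pair cursor next) ∷ assert (isMax (reg zero)) ∷ assign cursor (var next) ∷ []

finish : List Ins
finish = checkSymmetric ++ assert (eq (var cursor) (var start)) ∷ assign out cmax ∷ []

cubScheme : List Ins
cubScheme = initialise ++ repeat ctrl extend ++ assign cursor (var current) ∷ repeat ctrl stepBack ++ finish

cubProgram : Program
cubProgram = record { k = K ; l = 1 ; l≤k = s≤s z≤n ; a = 5 ; dims = arity ; body = cubScheme }

cubProgram-npsb : IsNPSB cubProgram
cubProgram-npsb = toWitness {a? = npsbₗ? cubScheme} _

module Correctness {n : ℕ} (E : Rel₂ n) (z m : Fin n) (z≢m : z ≢ m) where
  open Execution E z m {K} {5} {arity}

  Arrays : Set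
  Arrays = (A : Fin 5) → Vec (Fin n) (arity A) → Fin n

  arrs : St → Arrays
  arrs = State.arrs

  val : St → Fin K → Fin n
  val = State.vars

  σ₀ : St
  σ₀ = st (λ _ → z) (λ _ _ → z)

  -- A cell counts as set when it holds max: cells start at 0, and NPSB(1) writes nothing but max.
  InSub : Arrays → Fin n → Set
  InSub as v = as inSub (v ∷ []) ≡ m

  Link : Arrays → Fin n → Fin n → Set
  Link as x y = as link (x ∷ y ∷ []) ≡ m

  Nbr : Fin 3 → Arrays → Fin n → Fin n → Set
  Nbr j as x y = as (nbr j) (x ∷ y ∷ []) ≡ m

  Chosen : Arrays → Fin n → Fin n → Set
  Chosen as x y = ∃ λ j → Nbr j as x y

  chosen? : Arrays → Rel₂ n
  chosen? as x y = ⌊ any? (λ j → as (nbr j) (x ∷ y ∷ []) ≟ m) ⌋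

  chosen?≡true⇔ : ∀ as x y → chosen? as x y ≡ true ⇔ Chosen as x y
  chosen?≡true⇔ as x y = ⌊⌋≡true⇔ (any? (λ j → as (nbr j) (x ∷ y ∷ []) ≟ m))

  DistinctNeighbours : Fin n → (Fin 3 → Fin n) → Set
  DistinctNeighbours t nb = (∀ j → adj E t (nb j) ≡ true) × Injective _≡_ _≡_ nb

  DistinctNeighbours-cong : ∀ {t f g} → (∀ j → f j ≡ g j) → DistinctNeighbours t f → DistinctNeighbours t g
  DistinctNeighbours-cong {t} f≗g (adjacent-to , injective) =
    (λ j → subst (λ v → adj E t v ≡ true) (f≗g j) (adjacent-to j)) ,
    (λ e → injective (trans (f≗g _) (trans e (sym (f≗g _)))))

  RowOf : Arrays → Fin n → (Fin 3 → Fin n) → Set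
  RowOf as v nb = ∀ j y → Nbr j as v y ⇔ y ≡ nb j

  Untouched : Arrays → Fin n → Set
  Untouched as v = (∀ j y → ¬ Nbr j as v y) × (∀ y → ¬ Link as v y)

  record Grows (as as′ : Arrays) (w : Fin n) (nb : Fin 3 → Fin n) : Set where
    field
      inSub-grows : ∀ v → InSub as′ v ⇔ (v ≡ w ⊎ InSub as v)
      nbr-grows   : ∀ j x y → Nbr j as′ x y ⇔ ((x ≡ w × y ≡ nb j) ⊎ Nbr j as x y)
      link-grows  : ∀ x y → Link as′ x y → x ≡ w ⊎ Link as x y

    nbr-other : ∀ {j v y} → v ≢ w → Nbr j as′ v y ⇔ Nbr j as v y
    nbr-other {j} {v} {y} v≢w =
      ⇔.trans (nbr-grows j v y) (mk⇔ [ ⊥-elim ∘ v≢w ∘ proj₁ , id ]′ inj₂)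

  record WellFormed (P : Fin n → (Fin 3 → Fin n) → Set) (as : Arrays) : Set where
    field
      rows      : ∀ v → InSub as v → ∃ λ nb → P v nb × RowOf as v nb
      untouched : ∀ v → ¬ InSub as v → Untouched as v

    nbr⇒inSub : ∀ {j x y} → Nbr j as x y → InSub as x
    nbr⇒inSub {j} {x} {y} xy = decidable-stable (as inSub (x ∷ []) ≟ m) (λ x∉ → proj₁ (untouched x x∉) j y xy)

    link⇒inSub : ∀ {x y} → Link as x y → InSub as x
    link⇒inSub {x} {y} xy = decidable-stable (as inSub (x ∷ []) ≟ m) (λ x∉ → proj₂ (untouched x x∉) y xy)

  wellFormed-empty : ∀ {P} → WellFormed P (arrs σ₀)
  wellFormed-empty = record
    { rows      = λ _ z≡m → ⊥-elim (z≢m z≡m)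
    ; untouched = λ _ _ → (λ _ _ → z≢m) , (λ _ → z≢m) }

  wellFormed-grow : ∀ {P as as′ w nb} → WellFormed P as → ¬ InSub as w → P w nb → Grows as as′ w nb →
                    WellFormed P as′
  wellFormed-grow {as = as} {as′} {w} {nb} wf w∉ Pw grows = record { rows = rows′ ; untouched = untouched′ }
    where
      open WellFormed wf
      open Grows grows

      rows′ : ∀ v → InSub as′ v → ∃ λ nb′ → _ × RowOf as′ v nb′
      rows′ v v∈ with to (inSub-grows v) v∈
      ... | inj₁ refl = nb , Pw , λ j y → mk⇔
              ([ proj₂ , (λ wy → ⊥-elim (proj₁ (untouched w w∉) j y wy)) ]′ ∘ to (nbr-grows j w y))
              (λ y≡nbj → from (nbr-grows j w y) (inj₁ (refl , y≡nbj)))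
      ... | inj₂ v∈old =
              let nb′ , Pv , row = rows v v∈old
              in  nb′ , Pv , λ j y → ⇔.trans (nbr-other (λ { refl → w∉ v∈old })) (row j y)

      untouched′ : ∀ v → ¬ InSub as′ v → Untouched as′ v
      untouched′ v v∉ =
          (λ j y → [ v≢w ∘ proj₁ , proj₁ (untouched v v∉old) j y ]′ ∘ to (nbr-grows j v y))
        , (λ y → [ v≢w , proj₂ (untouched v v∉old) y ]′ ∘ link-grows v y)
        where
          v≢w : v ≢ w
          v≢w v≡w = v∉ (from (inSub-grows v) (inj₁ v≡w))
          v∉old : ¬ InSub as v
          v∉old = v∉ ∘ from (inSub-grows v) ∘ inj₂

  data Reach (as : Arrays) : Fin n → Fin n → Set where
    here  : ∀ {x} → Reach as x x
    there : ∀ {x y v} → Link as x y → Reach as y v → Reach as x v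

  reach-mono : ∀ {as as′} → (∀ {x y} → Link as x y → Link as′ x y) → ∀ {x v} → Reach as x v → Reach as′ x v
  reach-mono mono here         = here
  reach-mono mono (there xy r) = there (mono xy) (reach-mono mono r)

  record Chain (P : Fin n → (Fin 3 → Fin n) → Set) (as : Arrays) (s t : Fin n) : Set where
    field
      wellFormed      : WellFormed P as
      start-in        : InSub as s
      start-final     : ∀ y → ¬ Link as s y
      link-functional : ∀ {x y y′} → Link as x y → Link as x y′ → y ≡ y′
      reaches         : ∀ v → InSub as v → Reach as t v

  chain-extend : ∀ {P as as′ s t w nb} → Chain P as s t → ¬ InSub as w → P w nb → Grows as as′ w nb →
                 (∀ x y → Link as′ x y ⇔ ((x ≡ w × y ≡ t) ⊎ Link as x y)) → Chain P as′ s w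
  chain-extend {as = as} {as′} {s} {t} {w} chain w∉ Pw grows link′ = record
    { wellFormed      = wellFormed-grow wellFormed w∉ Pw grows
    ; start-in        = from (inSub-grows s) (inj₂ start-in)
    ; start-final     = λ y → [ (λ { (refl , _) → w∉ start-in }) , start-final y ]′ ∘ to (link′ s y)
    ; link-functional = functional′
    ; reaches         = reaches′ }
    where
      open Chain chain
      open Grows grows

      w-final : ∀ y → ¬ Link as w y
      w-final y = proj₂ (WellFormed.untouched wellFormed w w∉) y

      functional′ : ∀ {x y y′} → Link as′ x y → Link as′ x y′ → y ≡ y′
      functional′ {x} {y} {y′} xy xy′ with to (link′ x y) xy | to (link′ x y′) xy′
      ... | inj₁ (_ , y≡t)    | inj₁ (_ , y′≡t)  = trans y≡t (sym y′≡t)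
      ... | inj₁ (refl , _)   | inj₂ old         = ⊥-elim (w-final y′ old)
      ... | inj₂ old          | inj₁ (refl , _)  = ⊥-elim (w-final y old)
      ... | inj₂ old          | inj₂ old′        = link-functional old old′

      reaches′ : ∀ v → InSub as′ v → Reach as′ w v
      reaches′ v v∈ with to (inSub-grows v) v∈
      ... | inj₁ refl  = here
      ... | inj₂ v∈old = there (from (link′ w t) (inj₁ (refl , refl)))
                               (reach-mono (λ {x} {y} → from (link′ x y) ∘ inj₂) (reaches v v∈old))

  Verified : Arrays → Fin n → (Fin 3 → Fin n) → Set
  Verified as x ws = ∀ j → Nbr j as x (ws j) × Chosen as (ws j) x

  Symmetric : Arrays → Fin n → Set
  Symmetric as x = ∀ y → Chosen as x y → Chosen as y x

  verified⇒symmetric : ∀ {P as x ws} → WellFormed P as → Verified as x ws → Symmetric as x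
  verified⇒symmetric {as = as} {x} {ws} wf verified y (j , xy) =
    subst (λ v → Chosen as v x) wⱼ≡y (proj₂ (verified j))
    where
      row = proj₂ (proj₂ (WellFormed.rows wf x (WellFormed.nbr⇒inSub wf xy)))
      wⱼ≡y : ws j ≡ y
      wⱼ≡y = trans (to (row j (ws j)) (proj₁ (verified j))) (sym (to (row j y) xy))

  Swept : Arrays → Fin n → Set
  Swept as x = ∀ v → InSub as v → Symmetric as v ⊎ Reach as x v

  swept-step : ∀ {P as s t x y ws} → Chain P as s t → Swept as x → Verified as x ws → Link as x y → Swept as y
  swept-step chain swept verified xy v v∈ with swept v v∈
  ... | inj₁ symmetric       = inj₁ symmetric
  ... | inj₂ here            = inj₁ (verified⇒symmetric (Chain.wellFormed chain) verified)
  ... | inj₂ (there xy′ r) with Chain.link-functional chain xy xy′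
  ...   | refl = inj₂ r

  swept-finish : ∀ {P as s t ws} → Chain P as s t → Swept as s → Verified as s ws →
                 ∀ v → InSub as v → Symmetric as v
  swept-finish chain swept verified v v∈ with swept v v∈
  ... | inj₁ symmetric  = symmetric
  ... | inj₂ here       = verified⇒symmetric (Chain.wellFormed chain) verified
  ... | inj₂ (there sy _) = ⊥-elim (Chain.start-final chain _ sy)

  cub : ∀ {as s} → WellFormed DistinctNeighbours as → InSub as s → (∀ v → InSub as v → Symmetric as v) →
        CUB n E
  cub {as} {s} wf s∈ symmetric = chosen? as , F-sym , F-adj , F-nonempty , F-degree
    where
      open WellFormed wf

      flip : ∀ u v → Chosen as u v → Chosen as v u
      flip u v uv = symmetric u (nbr⇒inSub (proj₂ uv)) v uv

      F-sym : ∀ u v → chosen? as u v ≡ chosen? as v u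
      F-sym u v = ⇔→≡ (⇔.trans (chosen?≡true⇔ as u v)
                      (⇔.trans (mk⇔ (flip u v) (flip v u)) (⇔.sym (chosen?≡true⇔ as v u))))

      F-adj : ∀ u v → chosen? as u v ≡ true → adj E u v ≡ true
      F-adj u v Fuv =
        let j , uv = to (chosen?≡true⇔ as u v) Fuv
            nb , (adjacent-to , _) , row = rows u (nbr⇒inSub uv)
        in subst (λ w → adj E u w ≡ true) (sym (to (row j v) uv)) (adjacent-to j)

      F-nonempty : ∃₂ λ u v → chosen? as u v ≡ true
      F-nonempty =
        let nb , _ , row = rows s s∈
        in s , nb zero , from (chosen?≡true⇔ as s (nb zero)) (zero , from (row zero (nb zero)) refl)

      F-degree : ∀ u → degree (chosen? as) u ≡ 0 ⊎ degree (chosen? as) u ≡ 3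
      F-degree u with as inSub (u ∷ []) ≟ m
      ... | yes u∈ =
        let nb , (_ , injective) , row = rows u u∈
        in inj₂ (count-enumerated {f = nb} record
             { injective = injective
             ; image     = λ v → ⇔.trans (chosen?≡true⇔ as u v)
                 (mk⇔ (λ (j , uv) → j , sym (to (row j v) uv))
                      (λ (j , nbⱼ≡v) → j , from (row j v) (sym nbⱼ≡v))) })
      ... | no u∉ = inj₁ (count-none λ v → ¬-not λ Fuv →
              let j , uv = to (chosen?≡true⇔ as u v) Fuv in proj₁ (untouched u u∉) j v uv)

  inSub-mark : ∀ σ t v → InSub (arrs (setArr σ inSub (t ∷ []) m)) v ⇔ (v ≡ t ⊎ InSub (arrs σ) v)
  inSub-mark σ t v = ⇔.trans (setArr-max σ inSub (t ∷ []) (v ∷ [])) (∷[]-≡⇔ ⊎-⇔ ⇔.refl)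

  pair-mark : ∀ σ i x y u v →
              arrs (setArr σ (suc i) (x ∷ y ∷ []) m) (suc i) (u ∷ v ∷ []) ≡ m ⇔
              ((u ≡ x × v ≡ y) ⊎ arrs σ (suc i) (u ∷ v ∷ []) ≡ m)
  pair-mark σ i x y u v = ⇔.trans (setArr-max σ (suc i) (x ∷ y ∷ []) (u ∷ v ∷ [])) (∷∷[]-≡⇔ ⊎-⇔ ⇔.refl)

  neighboursTest⇔ : ∀ σ → Holds σ neighboursTest ⇔ DistinctNeighbours (val σ current) (val σ ∘ choice)
  neighboursTest⇔ σ = mk⇔
    (λ (a₀ , a₁ , a₂ , d₀₁ , d₀₂ , d₁₂) →
       (λ { zero             → from (evF≡true⇔ σ (adjacent current (choice zero))) a₀
          ; (suc zero)       → from (evF≡true⇔ σ (adjacent current (choice (# 1)))) a₁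
          ; (suc (suc zero)) → from (evF≡true⇔ σ (adjacent current (choice (# 2)))) a₂ })
       , distinct⇒injective d₀₁ d₀₂ d₁₂)
    (λ (adjacent-to , injective) →
         to (evF≡true⇔ σ (adjacent current (choice zero))) (adjacent-to zero)
       , to (evF≡true⇔ σ (adjacent current (choice (# 1)))) (adjacent-to (# 1))
       , to (evF≡true⇔ σ (adjacent current (choice (# 2)))) (adjacent-to (# 2))
       , (λ e → case injective {zero} {# 1} e of λ ())
       , (λ e → case injective {zero} {# 2} e of λ ())
       , (λ e → case injective {# 1} {# 2} e of λ ()))

  afterGuess : St → (Fin 3 → Fin n) → St
  afterGuess σ nb =
    setVar (setVar (setVar (setArr σ inSub (val σ current ∷ []) m)
      (choice zero) (nb zero)) (choice (# 1)) (nb (# 1))) (choice (# 2)) (nb (# 2))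

  afterGuess-choice : ∀ σ nb j → nb j ≡ val (afterGuess σ nb) (choice j)
  afterGuess-choice σ nb zero             = refl
  afterGuess-choice σ nb (suc zero)       = refl
  afterGuess-choice σ nb (suc (suc zero)) = refl

  afterChoose : St → (Fin 3 → Fin n) → St
  afterChoose σ nb =
    setArr (setArr (setArr (afterGuess σ nb) (nbr zero) (t ∷ nb zero ∷ []) m)
                   (nbr (# 1)) (t ∷ nb (# 1) ∷ []) m)
           (nbr (# 2)) (t ∷ nb (# 2) ∷ []) m
    where t = val σ current

  chooseNeighbours⁻ : ∀ {σ σ′} → ExecL chooseNeighbours σ σ′ →
                      ∃ λ nb → DistinctNeighbours (val σ current) nb × σ′ ≡ afterChoose σ nb
  chooseNeighbours⁻ {σ} (step writeE (step (guessE a) (step (guessE b) (step (guessE c) r)))) with assert⁻ r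
  ... | good , step writeE (step writeE (step writeE done)) =
    nb , DistinctNeighbours-cong (sym ∘ afterGuess-choice σ nb) (to (neighboursTest⇔ (afterGuess σ nb)) good) , refl
    where nb = lookup (a ∷ b ∷ c ∷ [])

  chooseNeighbours⁺ : ∀ σ nb → DistinctNeighbours (val σ current) nb → ExecL chooseNeighbours σ (afterChoose σ nb)
  chooseNeighbours⁺ σ nb good =
    step writeE (step (guessE (nb zero)) (step (guessE (nb (# 1))) (step (guessE (nb (# 2)))
      (assert⁺ (from (neighboursTest⇔ (afterGuess σ nb)) (DistinctNeighbours-cong (afterGuess-choice σ nb) good))
        (step writeE (step writeE (step writeE done)))))))

  afterChoose-grows : ∀ σ nb → Grows (arrs σ) (arrs (afterChoose σ nb)) (val σ current) nb
  afterChoose-grows σ nb = record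
    { inSub-grows = inSub-mark σ t
    ; nbr-grows   = λ where
        zero             → pair-mark (afterGuess σ nb) (suc zero) t (nb zero)
        (suc zero)       → pair-mark (setArr (afterGuess σ nb) (nbr zero) (t ∷ nb zero ∷ []) m)
                                     (# 2) t (nb (# 1))
        (suc (suc zero)) → pair-mark (setArr (setArr (afterGuess σ nb) (nbr zero) (t ∷ nb zero ∷ []) m)
                                             (nbr (# 1)) (t ∷ nb (# 1) ∷ []) m)
                                     (# 3) t (nb (# 2))
    ; link-grows  = λ _ _ → inj₂ }
    where t = val σ current

  afterInit : St → Fin n → (Fin 3 → Fin n) → St
  afterInit σ t nb = setVar (afterChoose (setVar σ current t) nb) start t

  initialise⁻ : ∀ {σ σ′} → ExecL initialise σ σ′ → ∃₂ λ t nb → DistinctNeighbours t nb × σ′ ≡ afterInit σ t nb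
  initialise⁻ (step (guessE t) r) with ExecL-++⁻ chooseNeighbours r
  ... | _ , r₁ , step assignE done with chooseNeighbours⁻ r₁
  ...   | nb , good , refl = t , nb , good , refl

  initialise⁺ : ∀ σ t nb → DistinctNeighbours t nb → ExecL initialise σ (afterInit σ t nb)
  initialise⁺ σ t nb good =
    step (guessE t) (ExecL-++⁺ (chooseNeighbours⁺ (setVar σ current t) nb good) (step assignE done))

  chain-initialise : ∀ {P} t nb → P t nb → Chain P (arrs (afterInit σ₀ t nb)) t t
  chain-initialise t nb Pt = record
    { wellFormed      = wellFormed-grow wellFormed-empty z≢m Pt grows
    ; start-in        = from (inSub-grows t) (inj₁ refl)
    ; start-final     = λ _ → z≢m
    ; link-functional = λ z≡m → ⊥-elim (z≢m z≡m)
    ; reaches         = λ v v∈ → [ (λ { refl → here }) , ⊥-elim ∘ z≢m ]′ (to (inSub-grows v) v∈) }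
    where
      grows = afterChoose-grows (setVar σ₀ current t) nb
      open Grows grows

  afterProbe : St → Fin n → St
  afterProbe σ w = setVar (setVar σ new w) (reg zero) (arrs σ inSub (w ∷ []))

  afterLink : St → Fin n → St
  afterLink σ w = setVar (setArr (afterProbe σ w) link (w ∷ val σ current ∷ []) m) current w

  afterExtend : St → Fin n → (Fin 3 → Fin n) → St
  afterExtend σ w nb = afterChoose (afterLink σ w) nb

  extend⁻ : ∀ {σ σ′} → ExecL extend σ σ′ →
            ∃₂ λ w nb → ¬ InSub (arrs σ) w × DistinctNeighbours w nb × σ′ ≡ afterExtend σ w nb
  extend⁻ (step (guessE w) (step readE r)) with assert⁻ r
  ... | w∉ , step writeE (step assignE r₁) with chooseNeighbours⁻ r₁
  ...   | nb , good , refl = w , nb , w∉ , good , refl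

  extend⁺ : ∀ σ w nb → ¬ InSub (arrs σ) w → DistinctNeighbours w nb → ExecL extend σ (afterExtend σ w nb)
  extend⁺ σ w nb w∉ good =
    step (guessE w) (step readE (assert⁺ w∉ (step writeE (step assignE (chooseNeighbours⁺ _ nb good)))))

  afterExtend-link : ∀ σ w nb x y →
                     Link (arrs (afterExtend σ w nb)) x y ⇔ ((x ≡ w × y ≡ val σ current) ⊎ Link (arrs σ) x y)
  afterExtend-link σ w nb x y = pair-mark (afterProbe σ w) zero w (val σ current) x y

  afterExtend-grows : ∀ σ w nb → Grows (arrs σ) (arrs (afterExtend σ w nb)) w nb
  afterExtend-grows σ w nb = record
    { inSub-grows = inSub-grows
    ; nbr-grows   = nbr-grows
    ; link-grows  = λ x y → [ inj₁ ∘ proj₁ , inj₂ ]′ ∘ to (afterExtend-link σ w nb x y) }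
    where open Grows (afterChoose-grows (afterLink σ w) nb)

  afterSlot : St → Fin 3 → Fin n → St
  afterSlot σ j w =
    setVar (setVar (setVar (setVar (setVar σ witness w)
      (reg zero) (arrs σ (nbr j) (x ∷ w ∷ [])))
      (reg zero) (arrs σ (nbr zero) (w ∷ x ∷ [])))
      (reg (# 1)) (arrs σ (nbr (# 1)) (w ∷ x ∷ [])))
      (reg (# 2)) (arrs σ (nbr (# 2)) (w ∷ x ∷ []))
    where x = val σ cursor

  checkSlot⁻ : ∀ j {σ σ′} → ExecL (checkSlot j) σ σ′ →
               ∃ λ w → Nbr j (arrs σ) (val σ cursor) w × Chosen (arrs σ) w (val σ cursor) × σ′ ≡ afterSlot σ j w
  checkSlot⁻ j (step (guessE w) (step readE r)) with assert⁻ r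
  ... | xw , step readE (step readE (step readE r₁)) with assert⁻ r₁
  ...   | wx , done = w , xw , to ⊎³⇔∃ wx , refl

  checkSlot⁺ : ∀ j σ w → Nbr j (arrs σ) (val σ cursor) w → Chosen (arrs σ) w (val σ cursor) →
               ExecL (checkSlot j) σ (afterSlot σ j w)
  checkSlot⁺ j σ w xw wx =
    step (guessE w) (step readE (assert⁺ xw (step readE (step readE (step readE
      (assert⁺ (from ⊎³⇔∃ wx) done))))))

  afterCheck : St → (Fin 3 → Fin n) → St
  afterCheck σ ws = afterSlot (afterSlot (afterSlot σ zero (ws zero)) (# 1) (ws (# 1))) (# 2) (ws (# 2))

  checkSymmetric⁻ : ∀ {σ σ′} → ExecL checkSymmetric σ σ′ →
                    ∃ λ ws → Verified (arrs σ) (val σ cursor) ws × σ′ ≡ afterCheck σ ws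
  checkSymmetric⁻ r with ExecL-++⁻ (checkSlot zero) r
  ... | _ , r₀ , r′ with ExecL-++⁻ (checkSlot (# 1)) r′
  ...   | _ , r₁ , r₂ with checkSlot⁻ zero r₀
  ...     | w₀ , xw₀ , w₀x , refl with checkSlot⁻ (# 1) r₁
  ...       | w₁ , xw₁ , w₁x , refl with checkSlot⁻ (# 2) r₂
  ...         | w₂ , xw₂ , w₂x , refl =
    lookup (w₀ ∷ w₁ ∷ w₂ ∷ []) ,
    (λ { zero → xw₀ , w₀x ; (suc zero) → xw₁ , w₁x ; (suc (suc zero)) → xw₂ , w₂x }) ,
    refl

  checkSymmetric⁺ : ∀ σ ws → Verified (arrs σ) (val σ cursor) ws → ExecL checkSymmetric σ (afterCheck σ ws)
  checkSymmetric⁺ σ ws verified =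
    ExecL-++⁺ (uncurry (checkSlot⁺ zero σ₁ (ws zero)) (verified zero))
   (ExecL-++⁺ (uncurry (checkSlot⁺ (# 1) σ₂ (ws (# 1))) (verified (# 1)))
              (uncurry (checkSlot⁺ (# 2) σ₃ (ws (# 2))) (verified (# 2))))
    where
      σ₁ = σ
      σ₂ = afterSlot σ₁ zero (ws zero)
      σ₃ = afterSlot σ₂ (# 1) (ws (# 1))

  afterStepBack : St → (Fin 3 → Fin n) → Fin n → St
  afterStepBack σ ws y =
    setVar (setVar (setVar (afterCheck σ ws) next y) (reg zero) (arrs σ link (val σ cursor ∷ y ∷ []))) cursor y

  stepBack⁻ : ∀ {σ σ′} → ExecL stepBack σ σ′ →
              ∃₂ λ ws y → Verified (arrs σ) (val σ cursor) ws × Link (arrs σ) (val σ cursor) y ×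
                          σ′ ≡ afterStepBack σ ws y
  stepBack⁻ r with ExecL-++⁻ checkSymmetric r
  ... | _ , r₁ , step (guessE y) (step readE r₂) with checkSymmetric⁻ r₁
  ...   | ws , verified , refl with assert⁻ r₂
  ...     | xy , step assignE done = ws , y , verified , xy , refl

  stepBack⁺ : ∀ σ ws y → Verified (arrs σ) (val σ cursor) ws → Link (arrs σ) (val σ cursor) y →
              ExecL stepBack σ (afterStepBack σ ws y)
  stepBack⁺ σ ws y verified xy =
    ExecL-++⁺ (checkSymmetric⁺ σ ws verified) (step (guessE y) (step readE (assert⁺ xy (step assignE done))))

  finish⁻ : ∀ {σ σ′} → ExecL finish σ σ′ →
            (∃ λ ws → Verified (arrs σ) (val σ cursor) ws) × val σ cursor ≡ val σ start
  finish⁻ r with ExecL-++⁻ checkSymmetric r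
  ... | _ , r₁ , r₂ with checkSymmetric⁻ r₁
  ...   | ws , verified , refl = (ws , verified) , proj₁ (assert⁻ r₂)

  finish⁺ : ∀ σ ws → Verified (arrs σ) (val σ cursor) ws → val σ cursor ≡ val σ start →
            ExecL finish σ (setVar (afterCheck σ ws) out m)
  finish⁺ σ ws verified x≡s = ExecL-++⁺ (checkSymmetric⁺ σ ws verified) (assert⁺ x≡s (step assignE done))

  SoundChain : St → Set
  SoundChain σ = Chain DistinctNeighbours (arrs σ) (val σ start) (val σ current)

  SoundSweep : St → Set
  SoundSweep σ = SoundChain σ × Swept (arrs σ) (val σ cursor)

  soundness : ∀ {σ′} → ExecL cubScheme σ₀ σ′ → CUB n E
  soundness r with ExecL-++⁻ initialise r
  ... | _ , r₁ , r′ with initialise⁻ r₁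
  ... | t , nb , good , refl with ExecL-++⁻ (repeat ctrl extend) r′
  ... | σ₂ , r₂ , step assignE r″ with ExecL-++⁻ (repeat ctrl stepBack) r″
  ... | σ₃ , r₃ , r₄ with finish⁻ r₄
  ... | (ws , verified) , x≡s =
    cub (Chain.wellFormed chain₃) (Chain.start-in chain₃)
        (swept-finish chain₃ (subst (Swept (arrs σ₃)) x≡s swept₃)
                             (subst (λ x → Verified (arrs σ₃) x ws) x≡s verified))
    where
      extend-step : ∀ {σ σ′} → SoundChain σ → ExecL extend σ σ′ → SoundChain σ′
      extend-step {σ} chain r with extend⁻ r
      ... | w , nb , w∉ , good , refl =
        chain-extend chain w∉ good (afterExtend-grows σ w nb) (afterExtend-link σ w nb)

      chain₂ : SoundChain σ₂
      chain₂ = repeat-invariant SoundChain (λ _ _ c → c) extend-step (chain-initialise t nb good) r₂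

      stepBack-step : ∀ {σ σ′} → SoundSweep σ → ExecL stepBack σ σ′ → SoundSweep σ′
      stepBack-step (chain , swept) r with stepBack⁻ r
      ... | ws , y , verified , xy , refl = chain , swept-step chain swept verified xy

      sweep₃ : SoundSweep σ₃
      sweep₃ = repeat-invariant SoundSweep (λ _ _ i → i) stepBack-step
                 (chain₂ , λ v v∈ → inj₂ (Chain.reaches chain₂ v v∈)) r₃

      chain₃ = proj₁ sweep₃
      swept₃ = proj₂ sweep₃

  module Completeness (F : Rel₂ n) (F-sym : ∀ u v → F u v ≡ F v u)
                      (F-adj : ∀ u v → F u v ≡ true → adj E u v ≡ true)
                      (F-degree : ∀ u → degree F u ≡ 0 ⊎ degree F u ≡ 3) where

    ExactNeighbours : Fin n → (Fin 3 → Fin n) → Set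
    ExactNeighbours v nb = Enumerates nb (F v)

    cubic : ∀ {u v} → F u v ≡ true → degree F u ≡ 3
    cubic {u} Fuv = [ ⊥-elim ∘ count≢0 (F u) Fuv , id ]′ (F-degree u)

    exact⇒distinct : ∀ {v nb} → ExactNeighbours v nb → DistinctNeighbours v nb
    exact⇒distinct {v} {nb} exact =
      (λ j → F-adj v (nb j) (from (image (nb j)) (j , refl))) , injective
      where open Enumerates exact

    Covers : Arrays → Set
    Covers as = ∀ v → degree F v ≡ 3 → InSub as v

    F⇒chosen : ∀ {as u v} → WellFormed ExactNeighbours as → InSub as u → F u v ≡ true → Chosen as u v
    F⇒chosen {u = u} {v} wf u∈ Fuv =
      let nb , exact , row = WellFormed.rows wf u u∈
          j , nbⱼ≡v = to (Enumerates.image exact v) Fuv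
      in j , from (row j v) (sym nbⱼ≡v)

    verify : ∀ {as x} → WellFormed ExactNeighbours as → Covers as → InSub as x → ∃ (Verified as x)
    verify {as} {x} wf covers x∈ =
      let nb , exact , row = WellFormed.rows wf x x∈
          back : ∀ j → F (nb j) x ≡ true
          back j = trans (F-sym (nb j) x) (from (Enumerates.image exact (nb j)) (j , refl))
      in nb , λ j → from (row j (nb j)) refl , F⇒chosen wf (covers (nb j) (cubic (back j))) (back j)

    CompleteChain : St → Set
    CompleteChain σ = Chain ExactNeighbours (arrs σ) (val σ start) (val σ current)

    extendAll : ∀ (vs : List (Fin n)) σ → CompleteChain σ →
                (∀ v → degree F v ≡ 3 → InSub (arrs σ) v ⊎ v ∈ vs) →
                ∃ λ τ → Iterates ctrl extend σ τ × CompleteChain τ × Covers (arrs τ)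
    extendAll [] σ chain pending = σ , [] , chain , λ v d → [ id , (λ ()) ]′ (pending v d)
    extendAll (w ∷ vs) σ chain pending with arrs σ inSub (w ∷ []) ≟ m | degree F w ℕ.≟ 3
    ... | yes w∈ | _ = extendAll vs σ chain λ v d →
          [ inj₁ , (λ { (here refl) → inj₁ w∈ ; (there v∈vs) → inj₂ v∈vs }) ]′ (pending v d)
    ... | no w∉ | no d≢3 = extendAll vs σ chain λ v d →
          [ inj₁ , (λ { (here refl) → ⊥-elim (d≢3 d) ; (there v∈vs) → inj₂ v∈vs }) ]′ (pending v d)
    ... | no w∉ | yes d≡3 =
          let τ , iterates , chain′ , covers = extendAll vs σ′ (chain-extend chain w∉ exact grows link′) pending′
          in τ , extend⁺ σᶜ w nb w∉ (exact⇒distinct exact) ∷ iterates , chain′ , covers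
      where
        σᶜ     = setVar σ ctrl z
        nb     = proj₁ (enumerate (F w) d≡3)
        exact  = proj₂ (enumerate (F w) d≡3)
        σ′     = afterExtend σᶜ w nb
        grows  = afterExtend-grows σᶜ w nb
        link′  = afterExtend-link σᶜ w nb
        open Grows grows
        pending′ : ∀ v → degree F v ≡ 3 → InSub (arrs σ′) v ⊎ v ∈ vs
        pending′ v d = [ inj₁ ∘ from (inSub-grows v) ∘ inj₂
                       , (λ { (here refl) → inj₁ (from (inSub-grows w) (inj₁ refl)) ; (there v∈vs) → inj₂ v∈vs }) ]′
                       (pending v d)

    walk : ∀ σ {x} → val σ cursor ≡ x → WellFormed ExactNeighbours (arrs σ) → Covers (arrs σ) →
           InSub (arrs σ) (val σ start) → Reach (arrs σ) x (val σ start) →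
           ∃ λ τ → Iterates ctrl stepBack σ τ × val τ cursor ≡ val τ start × ∃ (Verified (arrs τ) (val τ cursor))
    walk σ x≡s  wf covers s∈ here =
      σ , [] , x≡s , subst (λ x → ∃ (Verified (arrs σ) x)) (sym x≡s) (verify wf covers s∈)
    walk σ refl wf covers s∈ (there {y = y} xy r) =
      let ws , verified = verify wf covers (WellFormed.link⇒inSub wf xy)
          σᶜ = setVar σ ctrl z
          τ , iterates , x≡s , final = walk (afterStepBack σᶜ ws y) refl wf covers s∈ r
      in τ , stepBack⁺ σᶜ ws y verified xy ∷ iterates , x≡s , final

    completeness : ∀ {u₀ v₀} → F u₀ v₀ ≡ true → Accepts cubProgram n E z m
    completeness {u₀} F₀ =
      let nb , exact = enumerate (F u₀) (cubic F₀)
          σ₂ , iterates₂ , chain₂ , covers =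
            extendAll (allFin n) (afterInit σ₀ u₀ nb) (chain-initialise u₀ nb exact) (λ v _ → inj₂ (∈-allFin v))
          open Chain chain₂
          σ₃ = setVar (setVar σ₂ ctrl m) cursor (val σ₂ current)
          σ₄ , iterates₄ , x≡s , ws , verified = walk σ₃ refl wellFormed covers start-in (reaches _ start-in)
      in _ , ExecL-++⁺ (initialise⁺ σ₀ u₀ nb (exact⇒distinct exact))
               (ExecL-++⁺ (repeat⁺ z≢m iterates₂)
               (step assignE (ExecL-++⁺ (repeat⁺ z≢m iterates₄)
                                        (finish⁺ (setVar σ₄ ctrl m) ws verified x≡s))))
           , λ { zero → refl }

lemma8 : Σ Program λ P → IsNPSB P × AcceptsProblem P CUB
lemma8 = cubProgram , cubProgram-npsb , λ n E z m z≢m →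
    (λ (_ , run , _) → Correctness.soundness E z m z≢m run)
  , (λ (F , F-sym , F-adj , (_ , _ , F₀) , F-degree) →
       Correctness.Completeness.completeness E z m z≢m F F-sym F-adj F-degree F₀)
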